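{- Let $k\ge1$, $Q_k=3^{2k}-3^k+1=(2^k0^{k-1}1)_3$, $\mathcal{P}=X(1,7)$ and $\mathcal{Q}=X(1,Q_k)$. Then $\mathcal{Q}=\mathcal{P}^{(*k)}$.
   Context: $\mathbb{Z}_3$ is the ring of $3$-adic integers; $\Sigma_3$ is the set of $\alpha=\sum_{j\ge0}a_j3^j\in\mathbb{Z}_3$ with all digits $a_j\in\{0,1\}$. For a positive integer $M$, $\mathcal{C}(1,M)=\{\alpha\in\mathbb{Z}_3:\alpha\in\Sigma_3,\ M\alpha\in\Sigma_3\}$ and $X(1,M)\subset\{0,1,2\}^{\mathbb{N}}$ is the set of digit sequences $(a_0,a_1,\dots)$ of elements of $\mathcal{C}(1,M)$. For a set $\mathcal{X}\subset\{0,1,2\}^{\mathbb{N}}$ and $n\ge1$, $\mathcal{X}^{(*n)}=\{(x_i)_{i\ge0}: (x_j,x_{j+n},x_{j+2n},\dots)\in\mathcal{X}\text{ for all }0\le j\le n-1\}$. -}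

module Defs where

open import Data.Nat using (ℕ; zero; suc; _+_; _*_; _∸_; _^_; _≤_; _<_)
open import Data.Nat.DivMod using (_%_)
open import Data.Nat.Properties using (m^n≢0)
open import Data.Fin using (Fin; toℕ)
open import Data.Product using (_×_; ∃)
open import Relation.Binary.PropositionalEquality using (_≡_)

-- A 3-adic integer α = Σ_{j≥0} a_j 3^j is represented by its digit
-- sequence a : ℕ → Fin 3 (bijective correspondence Z_3 ≅ {0,1,2}^ℕ).
DigitSeq : Set
DigitSeq = ℕ → Fin 3

-- truncation: Σ_{j<n} a_j 3^j  (the image of α in Z/3^n)
trunc : DigitSeq → ℕ → ℕ
trunc a zero    = 0
trunc a (suc n) = trunc a n + toℕ (a n) * 3 ^ n

InΣ3 : DigitSeq → Set
InΣ3 a = ∀ j → toℕ (a j) ≤ 1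

-- b is the digit sequence of M·α (α with digits a), i.e. M·α ≡ β (mod 3^n) for all n
IsMul : ℕ → DigitSeq → DigitSeq → Set
IsMul M a b = ∀ n → _%_ (M * trunc a n) (3 ^ n) {{m^n≢0 3 n}} ≡ _%_ (trunc b n) (3 ^ n) {{m^n≢0 3 n}}

-- X(1,M): digit sequences of α ∈ C(1,M) = {α ∈ Σ_3 : Mα ∈ Σ_3}
X1 : ℕ → DigitSeq → Set
X1 M a = InΣ3 a × ∃ λ b → IsMul M a b × InΣ3 b

star : (DigitSeq → Set) → ℕ → DigitSeq → Set
star 𝒳 n x = ∀ j → j < n → 𝒳 (λ i → x (j + i * n))

Qk : ℕ → ℕ
Qk k = 3 ^ (2 * k) ∸ 3 ^ k + 1

module Submission where

-- Q_k α = β is the same as  α + 3^{2k} α = β + 3^k α.  For α, β ∈ Σ_3 both sides are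
-- sums of two numbers with digits in {0,1}, hence have digits ≤ 2 and are added without
-- carries; comparing digits, α ∈ X(1,Q_k) iff α ∈ Σ_3 and for every m
--   a_m + a_{m−2k} − a_{m−k} ∈ {0,1}        (a_j := 0 for j < 0),
-- and then this bit is the m-th digit of Q_k α.  The rule only couples positions in the same
-- class modulo k, and on the class j + kℕ it is exactly the rule for k = 1, i.e. for
-- Q_1 = 7.

open import Defs
open import Data.Nat
  using (ℕ; zero; suc; _+_; _*_; _∸_; _^_; _≤_; _<_; z≤n; s≤s; NonZero; >-nonZero)
open import Data.Nat.Properties
open import Data.Nat.DivMod using (_%_; _/_; m≡m%n+[m/n]*n; [m+kn]%n≡m%n; m<n⇒m%n≡m; m%n<n)
open import Data.Nat.Solver using (module +-*-Solver)
open import Data.Fin using (Fin; toℕ) renaming (zero to fzero; suc to fsuc)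
open import Data.Product using (_×_; _,_; ∃₂; proj₁; proj₂)
open import Function using (id)
open import Relation.Binary.Bundles using (Setoid)
open import Relation.Binary.PropositionalEquality
import Relation.Binary.Reasoning.Setoid
open +-*-Solver using (solve; _:+_; _:*_; _:=_; con)

-- (1) Congruence modulo N, in the subtraction-free form A + pN = B + qN.

infix 4 _≡_[mod_]
_≡_[mod_] : ℕ → ℕ → ℕ → Set
A ≡ B [mod N ] = ∃₂ λ p q → A + p * N ≡ B + q * N

module _ {N : ℕ} where

  mod-reflexive : ∀ {A B} → A ≡ B → A ≡ B [mod N ]
  mod-reflexive refl = 0 , 0 , refl

  mod-sym : ∀ {A B} → A ≡ B [mod N ] → B ≡ A [mod N ]
  mod-sym (p , q , e) = q , p , sym e

  mod-trans : ∀ {A B C} → A ≡ B [mod N ] → B ≡ C [mod N ] → A ≡ C [mod N ]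
  mod-trans {A} {B} {C} (p , q , e) (r , s , e′) = p + r , s + q , (begin
    A + (p + r) * N     ≡⟨ solve 4 (λ A p r N → A :+ (p :+ r) :* N := (A :+ p :* N) :+ r :* N) refl A p r N ⟩
    (A + p * N) + r * N ≡⟨ cong (_+ r * N) e ⟩
    (B + q * N) + r * N ≡⟨ solve 4 (λ B q r N → (B :+ q :* N) :+ r :* N := (B :+ r :* N) :+ q :* N) refl B q r N ⟩
    (B + r * N) + q * N ≡⟨ cong (_+ q * N) e′ ⟩
    (C + s * N) + q * N ≡⟨ solve 4 (λ C s q N → (C :+ s :* N) :+ q :* N := C :+ (s :+ q) :* N) refl C s q N ⟩
    C + (s + q) * N     ∎)
    where open ≡-Reasoning

  mod-setoid : Setoid _ _
  mod-setoid = record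
    { Carrier = ℕ
    ; _≈_ = λ A B → A ≡ B [mod N ]
    ; isEquivalence = record { refl = mod-reflexive refl ; sym = mod-sym ; trans = mod-trans }
    }

  mod-+ʳ : ∀ {A B} C → A ≡ B [mod N ] → A + C ≡ B + C [mod N ]
  mod-+ʳ {A} {B} C (p , q , e) = p , q , (begin
    A + C + p * N   ≡⟨ solve 4 (λ A C p N → A :+ C :+ p :* N := (A :+ p :* N) :+ C) refl A C p N ⟩
    (A + p * N) + C ≡⟨ cong (_+ C) e ⟩
    (B + q * N) + C ≡⟨ solve 4 (λ B C q N → (B :+ q :* N) :+ C := B :+ C :+ q :* N) refl B C q N ⟩
    B + C + q * N   ∎)
    where open ≡-Reasoning

  mod-+ʳ-cancel : ∀ {A B} C → A + C ≡ B + C [mod N ] → A ≡ B [mod N ]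
  mod-+ʳ-cancel {A} {B} C (p , q , e) = p , q , +-cancelʳ-≡ C _ _ (begin
    A + p * N + C ≡⟨ solve 4 (λ A C p N → A :+ p :* N :+ C := A :+ C :+ p :* N) refl A C p N ⟩
    A + C + p * N ≡⟨ e ⟩
    B + C + q * N ≡⟨ solve 4 (λ B C q N → B :+ C :+ q :* N := B :+ q :* N :+ C) refl B C q N ⟩
    B + q * N + C ∎)
    where open ≡-Reasoning

  mod-+ˡ : ∀ {A B} C → A ≡ B [mod N ] → C + A ≡ C + B [mod N ]
  mod-+ˡ {A} {B} C h =
    mod-trans (mod-reflexive (+-comm C A)) (mod-trans (mod-+ʳ C h) (mod-reflexive (+-comm B C)))

  mod-*ˡ : ∀ {A B} c → A ≡ B [mod N ] → c * A ≡ c * B [mod N ]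
  mod-*ˡ {A} {B} c (p , q , e) = c * p , c * q , (begin
    c * A + c * p * N ≡⟨ solve 4 (λ c A p N → c :* A :+ c :* p :* N := c :* (A :+ p :* N)) refl c A p N ⟩
    c * (A + p * N)   ≡⟨ cong (c *_) e ⟩
    c * (B + q * N)   ≡⟨ solve 4 (λ c B q N → c :* (B :+ q :* N) := c :* B :+ c :* q :* N) refl c B q N ⟩
    c * B + c * q * N ∎)
    where open ≡-Reasoning

  %≡⇒mod : .{{_ : NonZero N}} → ∀ {A B} → A % N ≡ B % N → A ≡ B [mod N ]
  %≡⇒mod {A} {B} e = B / N , A / N , (begin
    A + B / N * N                 ≡⟨ cong (_+ B / N * N) (m≡m%n+[m/n]*n A N) ⟩
    A % N + A / N * N + B / N * N ≡⟨ cong (λ r → r + A / N * N + B / N * N) e ⟩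
    B % N + A / N * N + B / N * N ≡⟨ solve 3 (λ r a b → r :+ a :+ b := r :+ b :+ a) refl (B % N) (A / N * N) (B / N * N) ⟩
    B % N + B / N * N + A / N * N ≡⟨ cong (_+ A / N * N) (sym (m≡m%n+[m/n]*n B N)) ⟩
    B + A / N * N                 ∎)
    where open ≡-Reasoning

  mod⇒%≡ : .{{_ : NonZero N}} → ∀ {A B} → A ≡ B [mod N ] → A % N ≡ B % N
  mod⇒%≡ {A} {B} (p , q , e) =
    trans (sym ([m+kn]%n≡m%n A p N)) (trans (cong (_% N) e) ([m+kn]%n≡m%n B q N))

  mod-<-unique : .{{_ : NonZero N}} → ∀ {A B} → A ≡ B [mod N ] → A < N → B < N → A ≡ B
  mod-<-unique h A<N B<N = trans (sym (m<n⇒m%n≡m A<N)) (trans (mod⇒%≡ h) (m<n⇒m%n≡m B<N))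

mod-1 : ∀ A B → A ≡ B [mod 1 ]
mod-1 A B = B , A , (begin
  A + B * 1 ≡⟨ cong (A +_) (*-identityʳ B) ⟩
  A + B     ≡⟨ +-comm A B ⟩
  B + A     ≡⟨ cong (B +_) (sym (*-identityʳ A)) ⟩
  B + A * 1 ∎)
  where open ≡-Reasoning

-- (2) Base-3 values of digit functions.  Digits may exceed 2 here: sums of two {0,1}-digit
-- sequences are handled digitwise before any carrying.

value : (ℕ → ℕ) → ℕ → ℕ
value g zero    = 0
value g (suc n) = value g n + g n * 3 ^ n

digit : DigitSeq → ℕ → ℕ
digit a m = toℕ (a m)

trunc≡value : ∀ a n → trunc a n ≡ value (digit a) n
trunc≡value a zero    = refl
trunc≡value a (suc n) = cong (_+ digit a n * 3 ^ n) (trunc≡value a n)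

value-cong : ∀ {f g} → (∀ m → f m ≡ g m) → ∀ n → value f n ≡ value g n
value-cong f≗g zero    = refl
value-cong f≗g (suc n) = cong₂ (λ v d → v + d * 3 ^ n) (value-cong f≗g n) (f≗g n)

value-+ : ∀ f g n → value (λ m → f m + g m) n ≡ value f n + value g n
value-+ f g zero    = refl
value-+ f g (suc n) rewrite value-+ f g n =
  solve 5 (λ a b c d e → a :+ b :+ (c :+ d) :* e := a :+ c :* e :+ (b :+ d :* e))
    refl (value f n) (value g n) (f n) (g n) (3 ^ n)

value<3^n : ∀ g → (∀ m → g m ≤ 2) → ∀ n → value g n < 3 ^ n
value<3^n g g≤2 zero    = s≤s z≤n
value<3^n g g≤2 (suc n) = begin-strict
  value g n + g n * 3 ^ n <⟨ +-monoˡ-< (g n * 3 ^ n) (value<3^n g g≤2 n) ⟩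
  3 ^ n + g n * 3 ^ n     ≤⟨ +-monoʳ-≤ (3 ^ n) (*-monoˡ-≤ (3 ^ n) (g≤2 n)) ⟩
  3 ^ n + 2 * 3 ^ n       ≡⟨ solve 1 (λ x → x :+ con 2 :* x := con 3 :* x) refl (3 ^ n) ⟩
  3 * 3 ^ n               ∎
  where open ≤-Reasoning

value-injective : ∀ f g → (∀ n → value f n ≡ value g n) → ∀ m → f m ≡ g m
value-injective f g same m = *-cancelʳ-≡ (f m) (g m) (3 ^ m) {{m^n≢0 3 m}}
  (+-cancelˡ-≡ (value f m) _ _ (trans (same (suc m)) (cong (_+ g m * 3 ^ m) (sym (same m)))))

digits-unique : ∀ f g → (∀ m → f m ≤ 2) → (∀ m → g m ≤ 2) →
  (∀ n → value f n ≡ value g n [mod 3 ^ n ]) → ∀ m → f m ≡ g m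
digits-unique f g f≤2 g≤2 congruent = value-injective f g λ n →
  mod-<-unique {{m^n≢0 3 n}} (congruent n) (value<3^n f f≤2 n) (value<3^n g g≤2 n)

-- (3) Shifting digits t places up, i.e. multiplying by 3^t.

-- shift t g has digits (0,…,0,g_0,g_1,…) with t leading zeros: the digits of 3^t·g.
shift1 : (ℕ → ℕ) → ℕ → ℕ
shift1 g zero    = 0
shift1 g (suc m) = g m

shift : ℕ → (ℕ → ℕ) → ℕ → ℕ
shift zero    g = g
shift (suc t) g = shift1 (shift t g)

shift-+ : ∀ t g m → shift t g (t + m) ≡ g m
shift-+ zero    g m = refl
shift-+ (suc t) g m = shift-+ t g m

shift-< : ∀ t g m → m < t → shift t g m ≡ 0
shift-< (suc t) g zero    _         = refl
shift-< (suc t) g (suc m) (s≤s m<t) = shift-< t g m m<t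

shift-cong : ∀ t {f g} → (∀ m → f m ≡ g m) → ∀ m → shift t f m ≡ shift t g m
shift-cong zero    f≗g m       = f≗g m
shift-cong (suc t) f≗g zero    = refl
shift-cong (suc t) f≗g (suc m) = shift-cong t f≗g m

shift-bound : ∀ t g B → (∀ m → g m ≤ B) → ∀ m → shift t g m ≤ B
shift-bound zero    g B g≤B m       = g≤B m
shift-bound (suc t) g B g≤B zero    = z≤n
shift-bound (suc t) g B g≤B (suc m) = shift-bound t g B g≤B m

value-shift1 : ∀ g n → value (shift1 g) (suc n) ≡ 3 * value g n
value-shift1 g zero    = refl
value-shift1 g (suc n) rewrite value-shift1 g n =
  solve 3 (λ v d x → con 3 :* v :+ d :* (con 3 :* x) := con 3 :* (v :+ d :* x))
    refl (value g n) (g n) (3 ^ n)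

-- Modulo 3^n, shifting once multiplies the value by 3: the extra top digit vanishes.
value-shift1-mod : ∀ g n → value (shift1 g) n ≡ 3 * value g n [mod 3 ^ n ]
value-shift1-mod g zero    = mod-1 _ _
value-shift1-mod g (suc n) = g n , 0 , (begin
  value (shift1 g) (suc n) + g n * 3 ^ suc n ≡⟨ cong (_+ g n * 3 ^ suc n) (value-shift1 g n) ⟩
  3 * value g n + g n * (3 * 3 ^ n)          ≡⟨ solve 3 (λ v d x → con 3 :* v :+ d :* (con 3 :* x) := con 3 :* (v :+ d :* x) :+ con 0 :* (con 3 :* x)) refl (value g n) (g n) (3 ^ n) ⟩
  3 * value g (suc n) + 0 * 3 ^ suc n        ∎)
  where open ≡-Reasoning

value-shift : ∀ t g n → value (shift t g) n ≡ 3 ^ t * value g n [mod 3 ^ n ]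
value-shift zero    g n = mod-reflexive (sym (*-identityˡ (value g n)))
value-shift (suc t) g n = begin
  value (shift1 (shift t g)) n ≈⟨ value-shift1-mod (shift t g) n ⟩
  3 * value (shift t g) n      ≈⟨ mod-*ˡ 3 (value-shift t g n) ⟩
  3 * (3 ^ t * value g n)      ≡⟨ *-assoc 3 (3 ^ t) (value g n) ⟨
  3 ^ suc t * value g n        ∎
  where open Relation.Binary.Reasoning.Setoid (mod-setoid {3 ^ n})

-- (4) The digit rule characterising X(1,Q_k).

-- Q_k + 3^k = 3^k·3^k + 1 (the truncated subtraction in Q_k does not truncate).
Qk+3^k : ∀ k → Qk k + 3 ^ k ≡ 3 ^ k * 3 ^ k + 1
Qk+3^k k = begin
  3 ^ (2 * k) ∸ 3 ^ k + 1 + 3 ^ k ≡⟨ solve 3 (λ d o y → d :+ o :+ y := d :+ y :+ o) refl (3 ^ (2 * k) ∸ 3 ^ k) 1 (3 ^ k) ⟩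
  3 ^ (2 * k) ∸ 3 ^ k + 3 ^ k + 1 ≡⟨ cong (_+ 1) (m∸n+n≡m 3^k≤3^2k) ⟩
  3 ^ (2 * k) + 1                 ≡⟨ cong (_+ 1) 3^2k≡3^k*3^k ⟩
  3 ^ k * 3 ^ k + 1               ∎
  where
  open ≡-Reasoning
  3^2k≡3^k*3^k : 3 ^ (2 * k) ≡ 3 ^ k * 3 ^ k
  3^2k≡3^k*3^k = trans (cong (λ e → 3 ^ (k + e)) (+-identityʳ k)) (^-distribˡ-+-* 3 k k)
  3^k≤3^2k : 3 ^ k ≤ 3 ^ (2 * k)
  3^k≤3^2k = subst (3 ^ k ≤_) (sym 3^2k≡3^k*3^k) (m≤m*n (3 ^ k) (3 ^ k) {{m^n≢0 3 k}})

Qk-shift-identity : ∀ k f n →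
  value f n + value (shift k (shift k f)) n ≡ Qk k * value f n + value (shift k f) n [mod 3 ^ n ]
Qk-shift-identity k f n = begin
  T + value (shift k (shift k f)) n ≈⟨ mod-+ˡ T (value-shift k (shift k f) n) ⟩
  T + y * value (shift k f) n       ≈⟨ mod-+ˡ T (mod-*ˡ y (value-shift k f n)) ⟩
  T + y * (y * T)                   ≡⟨ solve 2 (λ T y → T :+ y :* (y :* T) := (y :* y :+ con 1) :* T) refl T y ⟩
  (y * y + 1) * T                   ≡⟨ cong (_* T) (sym (Qk+3^k k)) ⟩
  (Qk k + y) * T                    ≡⟨ *-distribʳ-+ T (Qk k) y ⟩
  Qk k * T + y * T                  ≈⟨ mod-+ˡ (Qk k * T) (mod-sym (value-shift k f n)) ⟩
  Qk k * T + value (shift k f) n    ∎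
  where
  open Relation.Binary.Reasoning.Setoid (mod-setoid {3 ^ n})
  T = value f n
  y = 3 ^ k

IsMul⇒mod : ∀ M a b → IsMul M a b → ∀ n → M * value (digit a) n ≡ value (digit b) n [mod 3 ^ n ]
IsMul⇒mod M a b Ma≡b n = %≡⇒mod {{m^n≢0 3 n}}
  (subst₂ (λ A B → _%_ (M * A) (3 ^ n) {{m^n≢0 3 n}} ≡ _%_ B (3 ^ n) {{m^n≢0 3 n}})
    (trunc≡value a n) (trunc≡value b n) (Ma≡b n))

mod⇒IsMul : ∀ M a b → (∀ n → M * value (digit a) n ≡ value (digit b) n [mod 3 ^ n ]) → IsMul M a b
mod⇒IsMul M a b Ma≡b n =
  subst₂ (λ A B → _%_ (M * A) (3 ^ n) {{m^n≢0 3 n}} ≡ _%_ B (3 ^ n) {{m^n≢0 3 n}})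
    (sym (trunc≡value a n)) (sym (trunc≡value b n)) (mod⇒%≡ {{m^n≢0 3 n}} (Ma≡b n))

-- u + w − v is a bit 0 or 1.  With u = a_m, v = a_{m−k}, w = a_{m−2k} this bit is the m-th
-- digit of Q_k α.
data BitDifference (u v w : ℕ) : Set where
  bit0 : u + w ≡ v     → BitDifference u v w
  bit1 : u + w ≡ suc v → BitDifference u v w

bit : ∀ {u v w} → BitDifference u v w → Fin 3
bit (bit0 _) = fzero
bit (bit1 _) = fsuc fzero

bit≤1 : ∀ {u v w} (d : BitDifference u v w) → toℕ (bit d) ≤ 1
bit≤1 (bit0 _) = z≤n
bit≤1 (bit1 _) = s≤s z≤n

bit-equation : ∀ {u v w} (d : BitDifference u v w) → toℕ (bit d) + v ≡ u + w
bit-equation (bit0 e) = sym e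
bit-equation (bit1 e) = sym e

toBitDifference : ∀ {u v w} (d : Fin 3) → toℕ d ≤ 1 → u + w ≡ toℕ d + v → BitDifference u v w
toBitDifference fzero               _         e = bit0 e
toBitDifference (fsuc fzero)        _         e = bit1 e
toBitDifference (fsuc (fsuc fzero)) (s≤s ()) e

DigitRule : ℕ → (ℕ → ℕ) → ℕ → Set
DigitRule k f m = BitDifference (f m) (shift k f m) (shift k (shift k f) m)

-- α ∈ X(1,Q_k): comparing digits of α + 3^{2k}α and Q_kα + 3^kα, which have digits ≤ 2.
X1-Qk⇒rule : ∀ k a → X1 (Qk k) a → InΣ3 a × (∀ m → DigitRule k (digit a) m)
X1-Qk⇒rule k a (a∈Σ , b , Qa≡b , b∈Σ) = a∈Σ , λ m → toBitDifference (b m) (b∈Σ m) (lhs≡rhs m)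
  where
  f = digit a
  lhs rhs : ℕ → ℕ
  lhs m = f m + shift k (shift k f) m
  rhs m = digit b m + shift k f m
  shift≤1 : ∀ m → shift k f m ≤ 1
  shift≤1 = shift-bound k f 1 a∈Σ
  lhs≡rhs : ∀ m → lhs m ≡ rhs m
  lhs≡rhs = digits-unique lhs rhs
    (λ m → +-mono-≤ (a∈Σ m) (shift-bound k (shift k f) 1 shift≤1 m))
    (λ m → +-mono-≤ (b∈Σ m) (shift≤1 m))
    λ n → let open Relation.Binary.Reasoning.Setoid (mod-setoid {3 ^ n}) in begin
      value lhs n                                 ≡⟨ value-+ f (shift k (shift k f)) n ⟩
      value f n + value (shift k (shift k f)) n   ≈⟨ Qk-shift-identity k f n ⟩
      Qk k * value f n + value (shift k f) n      ≈⟨ mod-+ʳ (value (shift k f) n) (IsMul⇒mod (Qk k) a b Qa≡b n) ⟩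
      value (digit b) n + value (shift k f) n     ≡⟨ value-+ (digit b) (shift k f) n ⟨
      value rhs n                                 ∎

-- Conversely the bits given by the rule are the digits of Q_k α, which lies in Σ_3.
rule⇒X1-Qk : ∀ k a → InΣ3 a → (∀ m → DigitRule k (digit a) m) → X1 (Qk k) a
rule⇒X1-Qk k a a∈Σ rule = a∈Σ , b , mod⇒IsMul (Qk k) a b Qa≡b , λ m → bit≤1 (rule m)
  where
  f = digit a
  b : DigitSeq
  b m = bit (rule m)
  Qa≡b : ∀ n → Qk k * value f n ≡ value (digit b) n [mod 3 ^ n ]
  Qa≡b n = mod-sym (mod-+ʳ-cancel (value (shift k f) n) (begin
    value (digit b) n + value (shift k f) n     ≡⟨ value-+ (digit b) (shift k f) n ⟨
    value (λ m → digit b m + shift k f m) n     ≡⟨ value-cong (λ m → bit-equation (rule m)) n ⟩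
    value (λ m → f m + shift k (shift k f) m) n ≡⟨ value-+ f (shift k (shift k f)) n ⟩
    value f n + value (shift k (shift k f)) n   ≈⟨ Qk-shift-identity k f n ⟩
    Qk k * value f n + value (shift k f) n      ∎))
    where open Relation.Binary.Reasoning.Setoid (mod-setoid {3 ^ n})

-- (5) Restricting the digit rule to the residue classes modulo k.

module ResidueClasses (k : ℕ) .{{_ : NonZero k}} where

  class : {A : Set} → ℕ → (ℕ → A) → ℕ → A
  class j x i = x (j + i * k)

  shift-class : ∀ {j} → j < k → ∀ f i → shift k f (j + i * k) ≡ shift 1 (class j f) i
  shift-class {j} j<k f zero    = trans (cong (shift k f) (+-identityʳ j)) (shift-< k f j j<k)
  shift-class {j} j<k f (suc i) = trans (cong (shift k f) j+[k+ik]≡k+[j+ik]) (shift-+ k f (j + i * k))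
    where
    j+[k+ik]≡k+[j+ik] : j + (k + i * k) ≡ k + (j + i * k)
    j+[k+ik]≡k+[j+ik] = solve 3 (λ j k x → j :+ (k :+ x) := k :+ (j :+ x)) refl j k (i * k)

  rule-class : ∀ {j} → j < k → ∀ f i → DigitRule k f (j + i * k) ≡ DigitRule 1 (class j f) i
  rule-class j<k f i = cong₂ (BitDifference (class _ f i)) (shift-class j<k f i)
    (trans (shift-class j<k (shift k f) i) (shift-cong 1 (shift-class j<k f) i))

  -- Note that 7 = Q_1 by computation, so X(1,7) is the case k = 1 of part (4).
  X1-Qk⇒star : ∀ x → X1 (Qk k) x → star (X1 7) k x
  X1-Qk⇒star x x∈X j j<k = rule⇒X1-Qk 1 (class j x) (λ i → x∈Σ (j + i * k))
    λ i → subst id (rule-class j<k (digit x) i) (rule (j + i * k))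
    where
    x∈Σ = proj₁ (X1-Qk⇒rule k x x∈X)
    rule = proj₂ (X1-Qk⇒rule k x x∈X)

  -- Every position m is j + ik with j = m mod k < k and i = m div k.
  star⇒X1-Qk : ∀ x → star (X1 7) k x → X1 (Qk k) x
  star⇒X1-Qk x x∈star = rule⇒X1-Qk k x x∈Σ rule
    where
    classRule : ∀ m → InΣ3 (class (m % k) x) × (∀ i → DigitRule 1 (digit (class (m % k) x)) i)
    classRule m = X1-Qk⇒rule 1 (class (m % k) x) (x∈star (m % k) (m%n<n m k))
    m≡j+ik : ∀ m → m % k + m / k * k ≡ m
    m≡j+ik m = sym (m≡m%n+[m/n]*n m k)
    x∈Σ : InΣ3 x
    x∈Σ m = subst (λ p → toℕ (x p) ≤ 1) (m≡j+ik m) (proj₁ (classRule m) (m / k))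
    rule : ∀ m → DigitRule k (digit x) m
    rule m = subst (DigitRule k (digit x)) (m≡j+ik m)
      (subst id (sym (rule-class (m%n<n m k) (digit x) (m / k))) (proj₂ (classRule m) (m / k)))

proposition5p2 : (k : ℕ) → 1 ≤ k →
    (∀ x → X1 (Qk k) x → star (X1 7) k x) × (∀ x → star (X1 7) k x → X1 (Qk k) x)
proposition5p2 k 1≤k = X1-Qk⇒star , star⇒X1-Qk
  where open ResidueClasses k {{>-nonZero 1≤k}}
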